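{- Let $P=(h_1,\dots,h_k)$ be a partition of $n$, and let $B$ be a $k\times k$ array of multisets with elements from $[k]$ such that, for all $i,j\in[k]$: cell $(i,j)$ contains $h_i+h_j$ symbols (counted with multiplicity); row $i$ contains $h_i+h_j$ copies of symbol $j$; column $i$ contains $h_i+h_j$ copies of symbol $j$; and the entries in cell $(i,i)$ are all equal to symbol $i$. Then for every subset $D\subseteq[k]$, with $\overline{D}=[k]\setminus D$, $$(2k-2-3|D|)\sum_{j\in\overline{D}}h_j\ \ge\ (k+2-3|D|)\sum_{i\in D}h_i.$$
   Context: $[k]=\{1,\dots,k\}$. A partition of $n$ is a non-increasing sequence of positive integers summing to $n$. -}

module Defs where

open import Data.Nat using (ℕ; zero; suc; _+_; _≤_; _<_)
open import Data.Fin using (Fin; zero; suc)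
open import Data.Fin.Subset using (Subset)
open import Data.Vec using (lookup)
open import Data.Bool using (if_then_else_)
open import Data.Product using (_×_)
open import Relation.Binary.PropositionalEquality using (_≡_; _≢_)

sumFin : ∀ {k} → (Fin k → ℕ) → ℕ
sumFin {zero}  f = 0
sumFin {suc k} f = f zero + sumFin (λ i → f (suc i))

sumIn : ∀ {k} → Subset k → (Fin k → ℕ) → ℕ
sumIn D f = sumFin (λ i → if lookup D i then f i else 0)

IsPartition : (n k : ℕ) → (Fin k → ℕ) → Set
IsPartition n k h =
  (∀ (i j : Fin k) → Data.Fin._≤_ i j → h j ≤ h i) ×
  (∀ (i : Fin k) → 0 < h i) ×
  (sumFin h ≡ n)

-- A k×k array of multisets over [k] is given by multiplicities:
-- B i j s = number of copies of symbol s in cell (i,j).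
Array : ℕ → Set
Array k = Fin k → Fin k → Fin k → ℕ

IsValidArray : (k : ℕ) → (Fin k → ℕ) → Array k → Set
IsValidArray k h B =
  (∀ i j → sumFin (λ s → B i j s) ≡ h i + h j) ×
  (∀ i j → sumFin (λ c → B i c j) ≡ h i + h j) ×
  (∀ i j → sumFin (λ r → B r i j) ≡ h i + h j) ×
  (∀ i s → s ≢ i → B i i s ≡ 0)

-- Count the occurrences of symbols from D.  Write a = Σ_{i∈D} h_i, b = Σ_{i∉D} h_i,
-- d = |D|, m = |∁D|.  By the row condition the whole array holds d(a+b) + k a of them,
-- the rows indexed by D hold 2da, and by the column condition so do the columns indexed
-- by D.  Since  whole + (D×D block) = (D-rows) + (D-columns) + (∁D×∁D block),  and the
-- diagonal cells of the D×D block alone hold 2a such symbols while the ∁D×∁D block holds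
-- at most Σ_{i≠j ∉ D} (h_i + h_j) = 2mb − 2b (its diagonal cells hold none), we get
-- d(a+b) + ka + 2a + 2b ≤ 4da + 2mb, which for k = d + m is the claimed inequality.

module Submission where

open import Defs
open import Data.Nat using (ℕ)
open import Data.Fin using (Fin)
open import Data.Fin.Subset using (Subset; ∁; ∣_∣)
open import Data.Integer using (ℤ; +_; _-_; _*_; _≥_)

open import Data.Nat as ℕ using (zero; suc; _+_; _≤_; z≤n)
import Data.Nat.Properties as ℕ
import Data.Nat.Tactic.RingSolver as ℕ-Solver
import Data.Integer as ℤ
import Data.Integer.Properties as ℤ
import Data.Integer.Tactic.RingSolver as ℤ-Solver
open import Data.Fin using (zero; suc)
open import Data.Fin.Properties using (suc-injective)
open import Data.Fin.Subset.Properties using (∣∁p∣≡n∸∣p∣; ∣p∣≤n)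
open import Data.Bool using (true; false; not; if_then_else_)
open import Data.Bool.Properties using (not-¬; not-injective)
open import Data.Vec using (lookup; _∷_; [])
open import Data.Vec.Properties using (lookup-map)
open import Data.Product using (proj₁; proj₂)
open import Function using (_∘_)
open import Relation.Binary.PropositionalEquality
open import Algebra.Properties.Semiring.Sum ℕ.+-*-semiring
  using (sum; ∑-distrib-+; ∑-comm; *-distribˡ-sum)

sumFin≡sum : ∀ {k} (f : Fin k → ℕ) → sumFin f ≡ sum f
sumFin≡sum {zero}  f = refl
sumFin≡sum {suc k} f = cong (f zero ℕ.+_) (sumFin≡sum (f ∘ suc))

sumFin-cong : ∀ {k} {f g : Fin k → ℕ} → (∀ i → f i ≡ g i) → sumFin f ≡ sumFin g
sumFin-cong {zero}  f≗g = refl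
sumFin-cong {suc k} f≗g = cong₂ _+_ (f≗g zero) (sumFin-cong (f≗g ∘ suc))

sumFin-mono-≤ : ∀ {k} {f g : Fin k → ℕ} → (∀ i → f i ≤ g i) → sumFin f ≤ sumFin g
sumFin-mono-≤ {zero}  f≤g = z≤n
sumFin-mono-≤ {suc k} f≤g = ℕ.+-mono-≤ (f≤g zero) (sumFin-mono-≤ (f≤g ∘ suc))

sumFin-const : ∀ {k} c → sumFin {k} (λ _ → c) ≡ k ℕ.* c
sumFin-const {zero}  c = refl
sumFin-const {suc k} c = cong (c ℕ.+_) (sumFin-const {k} c)

sumFin-zero : ∀ {k} → sumFin {k} (λ _ → 0) ≡ 0
sumFin-zero {k} = trans (sumFin-const {k} 0) (ℕ.*-zeroʳ k)

sumFin-distrib-+ : ∀ {k} (f g : Fin k → ℕ) →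
  sumFin (λ i → f i + g i) ≡ sumFin f + sumFin g
sumFin-distrib-+ f g = begin
  sumFin (λ i → f i + g i) ≡⟨ sumFin≡sum (λ i → f i + g i) ⟩
  sum (λ i → f i + g i)    ≡⟨ ∑-distrib-+ f g ⟩
  sum f + sum g            ≡⟨ cong₂ _+_ (sumFin≡sum f) (sumFin≡sum g) ⟨
  sumFin f + sumFin g      ∎
  where open ≡-Reasoning

sumFin-comm : ∀ {k l} (f : Fin k → Fin l → ℕ) →
  sumFin (λ i → sumFin (f i)) ≡ sumFin (λ j → sumFin (λ i → f i j))
sumFin-comm f = begin
  sumFin (λ i → sumFin (f i))          ≡⟨ sumFin-cong (λ i → sumFin≡sum (f i)) ⟩
  sumFin (λ i → sum (f i))             ≡⟨ sumFin≡sum (λ i → sum (f i)) ⟩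
  sum (λ i → sum (f i))                ≡⟨ ∑-comm f ⟩
  sum (λ j → sum (λ i → f i j))        ≡⟨ sumFin≡sum (λ j → sum (λ i → f i j)) ⟨
  sumFin (λ j → sum (λ i → f i j))     ≡⟨ sumFin-cong (λ j → sumFin≡sum (λ i → f i j)) ⟨
  sumFin (λ j → sumFin (λ i → f i j))  ∎
  where open ≡-Reasoning

*-distribˡ-sumFin : ∀ {k} c (f : Fin k → ℕ) → sumFin (λ i → c ℕ.* f i) ≡ c ℕ.* sumFin f
*-distribˡ-sumFin c f = begin
  sumFin (λ i → c ℕ.* f i) ≡⟨ sumFin≡sum (λ i → c ℕ.* f i) ⟩
  sum (λ i → c ℕ.* f i)    ≡⟨ *-distribˡ-sum c f ⟨
  c ℕ.* sum f              ≡⟨ cong (c ℕ.*_) (sumFin≡sum f) ⟨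
  c ℕ.* sumFin f           ∎
  where open ≡-Reasoning

≤-sumFin : ∀ {k} (f : Fin k → ℕ) i → f i ≤ sumFin f
≤-sumFin f zero    = ℕ.m≤m+n (f zero) _
≤-sumFin f (suc i) = ℕ.≤-trans (≤-sumFin (f ∘ suc) i) (ℕ.m≤n+m _ (f zero))

sumFin-single : ∀ {k} (f : Fin k → ℕ) i → (∀ j → j ≢ i → f j ≡ 0) → sumFin f ≡ f i
sumFin-single {suc k} f zero    f≡0 = begin
  f zero + sumFin (f ∘ suc) ≡⟨ cong (f zero ℕ.+_) (sumFin-cong (λ j → f≡0 (suc j) λ ())) ⟩
  f zero + sumFin {k} (λ _ → 0) ≡⟨ cong (f zero ℕ.+_) (sumFin-zero {k}) ⟩
  f zero + 0                ≡⟨ ℕ.+-identityʳ (f zero) ⟩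
  f zero                    ∎
  where open ≡-Reasoning
sumFin-single {suc k} f (suc i) f≡0 =
  cong₂ _+_ (f≡0 zero λ ()) (sumFin-single (f ∘ suc) i λ j j≢i → f≡0 (suc j) (j≢i ∘ suc-injective))

sumFin-+-≤ : ∀ {k} {f g : Fin k → ℕ} i → (∀ j → f j ≤ g j) → f i ≡ 0 →
  sumFin f + g i ≤ sumFin g
sumFin-+-≤ {f = f} {g} zero f≤g fi≡0 = begin
  f zero + sumFin (f ∘ suc) + g zero ≡⟨ cong (λ x → x + sumFin (f ∘ suc) + g zero) fi≡0 ⟩
  sumFin (f ∘ suc) + g zero          ≡⟨ ℕ.+-comm _ (g zero) ⟩
  g zero + sumFin (f ∘ suc)          ≤⟨ ℕ.+-monoʳ-≤ (g zero) (sumFin-mono-≤ (f≤g ∘ suc)) ⟩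
  g zero + sumFin (g ∘ suc)          ∎
  where open ℕ.≤-Reasoning
sumFin-+-≤ {f = f} {g} (suc i) f≤g fi≡0 = begin
  f zero + sumFin (f ∘ suc) + g (suc i)   ≡⟨ ℕ.+-assoc (f zero) _ _ ⟩
  f zero + (sumFin (f ∘ suc) + g (suc i)) ≤⟨ ℕ.+-mono-≤ (f≤g zero) (sumFin-+-≤ i (f≤g ∘ suc) fi≡0) ⟩
  g zero + sumFin (g ∘ suc)               ∎
  where open ℕ.≤-Reasoning

-- sumIn D f unfolds to sumFin (restrict D f).
restrict : ∀ {k} → Subset k → (Fin k → ℕ) → Fin k → ℕ
restrict D f i = if lookup D i then f i else 0

restrict-∈ : ∀ {k} (D : Subset k) (f : Fin k → ℕ) {i} → lookup D i ≡ true → restrict D f i ≡ f i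
restrict-∈ D f i∈D rewrite i∈D = refl

sumIn-cong : ∀ {k} (D : Subset k) {f g : Fin k → ℕ} →
  (∀ i → lookup D i ≡ true → f i ≡ g i) → sumIn D f ≡ sumIn D g
sumIn-cong D {f} {g} f≗g = sumFin-cong pointwise
  where
  pointwise : ∀ i → restrict D f i ≡ restrict D g i
  pointwise i with lookup D i in i∈D
  ... | true  = f≗g i i∈D
  ... | false = refl

sumIn-mono-≤ : ∀ {k} (D : Subset k) {f g : Fin k → ℕ} →
  (∀ i → lookup D i ≡ true → f i ≤ g i) → sumIn D f ≤ sumIn D g
sumIn-mono-≤ D {f} {g} f≤g = sumFin-mono-≤ pointwise
  where
  pointwise : ∀ i → restrict D f i ≤ restrict D g i
  pointwise i with lookup D i in i∈D
  ... | true  = f≤g i i∈D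
  ... | false = z≤n

sumIn-distrib-+ : ∀ {k} (D : Subset k) (f g : Fin k → ℕ) →
  sumIn D (λ i → f i + g i) ≡ sumIn D f + sumIn D g
sumIn-distrib-+ D f g = trans (sumFin-cong pointwise) (sumFin-distrib-+ (restrict D f) (restrict D g))
  where
  pointwise : ∀ i → restrict D (λ i → f i + g i) i ≡ restrict D f i + restrict D g i
  pointwise i with lookup D i
  ... | true  = refl
  ... | false = refl

*-distribˡ-sumIn : ∀ {k} (D : Subset k) c (f : Fin k → ℕ) →
  sumIn D (λ i → c ℕ.* f i) ≡ c ℕ.* sumIn D f
*-distribˡ-sumIn D c f = trans (sumFin-cong pointwise) (*-distribˡ-sumFin c (restrict D f))
  where
  pointwise : ∀ i → restrict D (λ i → c ℕ.* f i) i ≡ c ℕ.* restrict D f i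
  pointwise i with lookup D i
  ... | true  = refl
  ... | false = sym (ℕ.*-zeroʳ c)

sumIn-const : ∀ {k} (D : Subset k) c → sumIn D (λ _ → c) ≡ ∣ D ∣ ℕ.* c
sumIn-const []          c = refl
sumIn-const (true ∷ D)  c = cong (c ℕ.+_) (sumIn-const D c)
sumIn-const (false ∷ D) c = sumIn-const D c

sumIn-comm : ∀ {k l} (D : Subset k) (f : Fin k → Fin l → ℕ) →
  sumIn D (λ i → sumFin (f i)) ≡ sumFin (λ j → sumIn D (λ i → f i j))
sumIn-comm {l = l} D f = trans (sumFin-cong pointwise) (sumFin-comm (λ i j → restrict D (λ i → f i j) i))
  where
  pointwise : ∀ i → restrict D (λ i → sumFin (f i)) i ≡ sumFin (λ j → restrict D (λ i → f i j) i)
  pointwise i with lookup D i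
  ... | true  = refl
  ... | false = sym (sumFin-zero {l})

sumFin-split : ∀ {k} (D : Subset k) (f : Fin k → ℕ) → sumFin f ≡ sumIn D f + sumIn (∁ D) f
sumFin-split D f = trans (sumFin-cong pointwise) (sumFin-distrib-+ (restrict D f) (restrict (∁ D) f))
  where
  pointwise : ∀ i → f i ≡ restrict D f i + restrict (∁ D) f i
  pointwise i rewrite lookup-map i not D with lookup D i
  ... | true  = sym (ℕ.+-identityʳ (f i))
  ... | false = refl

sumIn≤sumFin : ∀ {k} (D : Subset k) (f : Fin k → ℕ) → sumIn D f ≤ sumFin f
sumIn≤sumFin D f = sumFin-mono-≤ pointwise
  where
  pointwise : ∀ i → restrict D f i ≤ f i
  pointwise i with lookup D i
  ... | true  = ℕ.≤-refl
  ... | false = z≤n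

≤-sumIn : ∀ {k} (D : Subset k) (f : Fin k → ℕ) {i} → lookup D i ≡ true → f i ≤ sumIn D f
≤-sumIn D f {i} i∈D = subst (_≤ sumIn D f) (restrict-∈ D f i∈D) (≤-sumFin (restrict D f) i)

sumIn-+-≤ : ∀ {k} (D : Subset k) {f g : Fin k → ℕ} {i} → lookup D i ≡ true →
  (∀ j → lookup D j ≡ true → f j ≤ g j) → f i ≡ 0 → sumIn D f + g i ≤ sumIn D g
sumIn-+-≤ D {f} {g} {i} i∈D f≤g fi≡0 =
  subst (λ x → sumIn D f + x ≤ sumIn D g) (restrict-∈ D g i∈D)
    (sumFin-+-≤ i pointwise (trans (restrict-∈ D f i∈D) fi≡0))
  where
  pointwise : ∀ j → restrict D f j ≤ restrict D g j
  pointwise j with lookup D j in j∈D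
  ... | true  = f≤g j j∈D
  ... | false = z≤n

∣p∣+∣∁p∣≡n : ∀ {k} (D : Subset k) → ∣ D ∣ + ∣ ∁ D ∣ ≡ k
∣p∣+∣∁p∣≡n D = trans (cong (∣ D ∣ ℕ.+_) (∣∁p∣≡n∸∣p∣ D)) (ℕ.m+[n∸m]≡n (∣p∣≤n D))

sumIn-pairs : ∀ {k} (E : Subset k) (h : Fin k → ℕ) →
  sumIn E (λ i → sumIn E (λ j → h i + h j)) ≡ ∣ E ∣ ℕ.* sumIn E h + ∣ E ∣ ℕ.* sumIn E h
sumIn-pairs E h = begin
  sumIn E (λ i → sumIn E (λ j → h i + h j))     ≡⟨ sumIn-cong E (λ i _ → row i) ⟩
  sumIn E (λ i → ∣ E ∣ ℕ.* h i + sumIn E h)       ≡⟨ sumIn-distrib-+ E _ _ ⟩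
  sumIn E (λ i → ∣ E ∣ ℕ.* h i) + sumIn E (λ _ → sumIn E h)
    ≡⟨ cong₂ _+_ (*-distribˡ-sumIn E ∣ E ∣ h) (sumIn-const E (sumIn E h)) ⟩
  ∣ E ∣ ℕ.* sumIn E h + ∣ E ∣ ℕ.* sumIn E h      ∎
  where
  open ≡-Reasoning
  row : ∀ i → sumIn E (λ j → h i + h j) ≡ ∣ E ∣ ℕ.* h i + sumIn E h
  row i = trans (sumIn-distrib-+ E (λ _ → h i) h) (cong (_+ sumIn E h) (sumIn-const E (h i)))

sumFin²-blocks : ∀ {k} (D : Subset k) (Y : Fin k → Fin k → ℕ) →
  sumFin (λ i → sumFin (Y i)) + sumIn D (λ i → sumIn D (Y i))
    ≡ sumIn D (λ i → sumFin (Y i)) + sumFin (λ i → sumIn D (Y i))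
      + sumIn (∁ D) (λ i → sumIn (∁ D) (Y i))
sumFin²-blocks D Y = begin
  all + P           ≡⟨ cong (_+ P) all≡R+Q+Z ⟩
  R + (Q + Z) + P   ≡⟨ rearrange R Q Z P ⟩
  R + (P + Q) + Z   ≡⟨ cong (λ x → R + x + Z) (sumFin-split D (λ i → sumIn D (Y i))) ⟨
  R + C + Z         ∎
  where
  open ≡-Reasoning
  all = sumFin (λ i → sumFin (Y i))
  R = sumIn D (λ i → sumFin (Y i))
  C = sumFin (λ i → sumIn D (Y i))
  P = sumIn D (λ i → sumIn D (Y i))
  Q = sumIn (∁ D) (λ i → sumIn D (Y i))
  Z = sumIn (∁ D) (λ i → sumIn (∁ D) (Y i))
  all≡R+Q+Z : all ≡ R + (Q + Z)
  all≡R+Q+Z = trans (sumFin-split D (λ i → sumFin (Y i))) (cong (R ℕ.+_)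
    (trans (sumIn-cong (∁ D) (λ i _ → sumFin-split D (Y i))) (sumIn-distrib-+ (∁ D) _ _)))
  rearrange : ∀ r q z p → r + (q + z) + p ≡ r + (p + q) + z
  rearrange = ℕ-Solver.solve-∀

module ValidArray {k} {h : Fin k → ℕ} {B : Array k} (valid : IsValidArray k h B) where

  private
    cell-size : ∀ i j → sumFin (B i j) ≡ h i + h j
    cell-size = proj₁ valid
    row-count : ∀ i s → sumFin (λ j → B i j s) ≡ h i + h s
    row-count = proj₁ (proj₂ valid)
    column-count : ∀ j s → sumFin (λ i → B i j s) ≡ h j + h s
    column-count = proj₁ (proj₂ (proj₂ valid))
    diagonal : ∀ i s → s ≢ i → B i i s ≡ 0
    diagonal = proj₂ (proj₂ (proj₂ valid))

  row-symbols : ∀ (S : Subset k) i → sumFin (λ j → sumIn S (B i j)) ≡ sumIn S (λ s → h i + h s)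
  row-symbols S i = trans (sym (sumIn-comm S (λ s j → B i j s))) (sumIn-cong S (λ s _ → row-count i s))

  column-symbols : ∀ (S : Subset k) j → sumFin (λ i → sumIn S (B i j)) ≡ sumIn S (λ s → h j + h s)
  column-symbols S j = trans (sym (sumIn-comm S (λ s i → B i j s))) (sumIn-cong S (λ s _ → column-count j s))

  diagonal-cell : ∀ i → B i i i ≡ h i + h i
  diagonal-cell i = trans (sym (sumFin-single (B i i) i (diagonal i))) (cell-size i i)

  diagonal-cell-outside : ∀ (S : Subset k) i → lookup S i ≡ false → sumIn S (B i i) ≡ 0
  diagonal-cell-outside S i i∉S = trans (sumIn-cong S vanishes) (trans (sumIn-const S 0) (ℕ.*-zeroʳ ∣ S ∣))
    where
    vanishes : ∀ s → lookup S s ≡ true → B i i s ≡ 0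
    vanishes s s∈S = diagonal i s λ { refl → not-¬ s∈S i∉S }

  cell-symbols-≤ : ∀ (S : Subset k) i j → sumIn S (B i j) ≤ h i + h j
  cell-symbols-≤ S i j = subst (sumIn S (B i j) ≤_) (cell-size i j) (sumIn≤sumFin S (B i j))

  module _ (D : Subset k) where

    private
      a b d m : ℕ
      a = sumIn D h
      b = sumIn (∁ D) h
      d = ∣ D ∣
      m = ∣ ∁ D ∣
      Y : Fin k → Fin k → ℕ
      Y i j = sumIn D (B i j)

    all-symbols : sumFin (λ i → sumFin (Y i)) ≡ d ℕ.* (a + b) + k ℕ.* a
    all-symbols = begin
      sumFin (λ i → sumFin (Y i))                  ≡⟨ sumFin-cong (row-symbols D) ⟩
      sumFin (λ i → sumIn D (λ s → h i + h s))     ≡⟨ sumIn-comm D (λ s i → h i + h s) ⟨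
      sumIn D (λ s → sumFin (λ i → h i + h s))     ≡⟨ sumIn-cong D (λ s _ → column s) ⟩
      sumIn D (λ s → (a + b) + k ℕ.* h s)          ≡⟨ sumIn-distrib-+ D _ _ ⟩
      sumIn D (λ _ → a + b) + sumIn D (λ s → k ℕ.* h s)
        ≡⟨ cong₂ _+_ (sumIn-const D (a + b)) (*-distribˡ-sumIn D k h) ⟩
      d ℕ.* (a + b) + k ℕ.* a                      ∎
      where
      open ≡-Reasoning
      column : ∀ s → sumFin (λ i → h i + h s) ≡ (a + b) + k ℕ.* h s
      column s = trans (sumFin-distrib-+ h (λ _ → h s))
        (cong₂ _+_ (sumFin-split D h) (sumFin-const {k} (h s)))

    rows-in-D : sumIn D (λ i → sumFin (Y i)) ≡ d ℕ.* a + d ℕ.* a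
    rows-in-D = trans (sumIn-cong D (λ i _ → row-symbols D i)) (sumIn-pairs D h)

    columns-in-D : sumFin (λ i → sumIn D (Y i)) ≡ d ℕ.* a + d ℕ.* a
    columns-in-D = trans (sym (sumIn-comm D (λ j i → Y i j)))
      (trans (sumIn-cong D (λ j _ → column-symbols D j)) (sumIn-pairs D h))

    block-D-≥ : a + a ≤ sumIn D (λ i → sumIn D (Y i))
    block-D-≥ = begin
      a + a                             ≡⟨ sumIn-distrib-+ D h h ⟨
      sumIn D (λ i → h i + h i)         ≤⟨ sumIn-mono-≤ D diagonal-entry ⟩
      sumIn D (λ i → sumIn D (Y i))     ∎
      where
      open ℕ.≤-Reasoning
      diagonal-entry : ∀ i → lookup D i ≡ true → h i + h i ≤ sumIn D (Y i)
      diagonal-entry i i∈D = begin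
        h i + h i     ≡⟨ diagonal-cell i ⟨
        B i i i       ≤⟨ ≤-sumIn D (B i i) i∈D ⟩
        Y i i         ≤⟨ ≤-sumIn D (Y i) i∈D ⟩
        sumIn D (Y i) ∎

    block-∁D-≤ : sumIn (∁ D) (λ i → sumIn (∁ D) (Y i)) + (b + b) ≤ m ℕ.* b + m ℕ.* b
    block-∁D-≤ = begin
      sumIn (∁ D) (λ i → sumIn (∁ D) (Y i)) + (b + b)
        ≡⟨ cong (sumIn (∁ D) (λ i → sumIn (∁ D) (Y i)) ℕ.+_) (sumIn-distrib-+ (∁ D) h h) ⟨
      sumIn (∁ D) (λ i → sumIn (∁ D) (Y i)) + sumIn (∁ D) (λ i → h i + h i)
        ≡⟨ sumIn-distrib-+ (∁ D) _ _ ⟨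
      sumIn (∁ D) (λ i → sumIn (∁ D) (Y i) + (h i + h i))
        ≤⟨ sumIn-mono-≤ (∁ D) row ⟩
      sumIn (∁ D) (λ i → sumIn (∁ D) (λ j → h i + h j))
        ≡⟨ sumIn-pairs (∁ D) h ⟩
      m ℕ.* b + m ℕ.* b ∎
      where
      open ℕ.≤-Reasoning
      -- Cell (i, i) holds no symbol from D, so it contributes nothing to the left-hand sum.
      row : ∀ i → lookup (∁ D) i ≡ true → sumIn (∁ D) (Y i) + (h i + h i) ≤ sumIn (∁ D) (λ j → h i + h j)
      row i i∈∁D = sumIn-+-≤ (∁ D) i∈∁D (λ j _ → cell-symbols-≤ D i j)
        (diagonal-cell-outside D i (not-injective (trans (sym (lookup-map i not D)) i∈∁D)))

    counting-bound : d ℕ.* (a + b) + k ℕ.* a + (a + a) + (b + b)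
                       ≤ (d ℕ.* a + d ℕ.* a) + (d ℕ.* a + d ℕ.* a) + (m ℕ.* b + m ℕ.* b)
    counting-bound = begin
      d ℕ.* (a + b) + k ℕ.* a + (a + a) + (b + b) ≡⟨ cong (λ x → x + (a + a) + (b + b)) all-symbols ⟨
      all + (a + a) + (b + b)      ≤⟨ ℕ.+-monoˡ-≤ (b + b) (ℕ.+-monoʳ-≤ all block-D-≥) ⟩
      all + P + (b + b)            ≡⟨ cong (_+ (b + b)) (sumFin²-blocks D Y) ⟩
      R + C + Z + (b + b)          ≡⟨ ℕ.+-assoc (R + C) Z (b + b) ⟩
      R + C + (Z + (b + b))        ≤⟨ ℕ.+-monoʳ-≤ (R + C) block-∁D-≤ ⟩
      R + C + (m ℕ.* b + m ℕ.* b)  ≡⟨ cong₂ (λ x y → x + y + (m ℕ.* b + m ℕ.* b)) rows-in-D columns-in-D ⟩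
      (d ℕ.* a + d ℕ.* a) + (d ℕ.* a + d ℕ.* a) + (m ℕ.* b + m ℕ.* b) ∎
      where
      open ℕ.≤-Reasoning
      all = sumFin (λ i → sumFin (Y i))
      R = sumIn D (λ i → sumFin (Y i))
      C = sumFin (λ i → sumIn D (Y i))
      P = sumIn D (λ i → sumIn D (Y i))
      Z = sumIn (∁ D) (λ i → sumIn (∁ D) (Y i))

counting-bound⇒inequality : ∀ {k} d m a b → d + m ≡ k →
  d ℕ.* (a + b) + k ℕ.* a + (a + a) + (b + b)
    ≤ (d ℕ.* a + d ℕ.* a) + (d ℕ.* a + d ℕ.* a) + (m ℕ.* b + m ℕ.* b) →
  (+ (2 ℕ.* k) - + 2 - + (3 ℕ.* d)) * + b ≥ (+ (k ℕ.+ 2) - + (3 ℕ.* d)) * + a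
counting-bound⇒inequality d m a b refl bound =
  ℤ.0≤i-j⇒j≤i (subst (ℤ.0ℤ ℤ.≤_) difference (ℤ.i≤j⇒0≤j-i (subst₂ ℤ._≤_ lhs rhs (ℤ.+≤+ bound))))
  where
  open ≡-Reasoning
  -- The casts of sums are definitional, only products need pos-*.
  lhs : + (d ℕ.* (a + b) + (d + m) ℕ.* a + (a + a) + (b + b))
        ≡ + d * (+ a ℤ.+ + b) ℤ.+ (+ d ℤ.+ + m) * + a ℤ.+ (+ a ℤ.+ + a) ℤ.+ (+ b ℤ.+ + b)
  lhs = cong₂ ℤ._+_ (cong₂ ℤ._+_ (cong₂ ℤ._+_ (ℤ.pos-* d (a + b)) (ℤ.pos-* (d + m) a)) refl) refl
  rhs : + ((d ℕ.* a + d ℕ.* a) + (d ℕ.* a + d ℕ.* a) + (m ℕ.* b + m ℕ.* b))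
        ≡ (+ d * + a ℤ.+ + d * + a) ℤ.+ (+ d * + a ℤ.+ + d * + a) ℤ.+ (+ m * + b ℤ.+ + m * + b)
  rhs = cong₂ ℤ._+_ (cong₂ ℤ._+_ twice-da twice-da) (cong₂ ℤ._+_ (ℤ.pos-* m b) (ℤ.pos-* m b))
    where
    twice-da : + (d ℕ.* a + d ℕ.* a) ≡ + d * + a ℤ.+ + d * + a
    twice-da = cong₂ ℤ._+_ (ℤ.pos-* d a) (ℤ.pos-* d a)
  difference : (+ d * + a ℤ.+ + d * + a) ℤ.+ (+ d * + a ℤ.+ + d * + a) ℤ.+ (+ m * + b ℤ.+ + m * + b)
                 - (+ d * (+ a ℤ.+ + b) ℤ.+ (+ d ℤ.+ + m) * + a ℤ.+ (+ a ℤ.+ + a) ℤ.+ (+ b ℤ.+ + b))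
               ≡ (+ (2 ℕ.* (d + m)) - + 2 - + (3 ℕ.* d)) * + b - (+ (d + m ℕ.+ 2) - + (3 ℕ.* d)) * + a
  difference = begin
    _ ≡⟨ identity (+ d) (+ m) (+ a) (+ b) ⟩
    (+ 2 * (+ d ℤ.+ + m) - + 2 - + 3 * + d) * + b - (+ d ℤ.+ + m ℤ.+ + 2 - + 3 * + d) * + a
      ≡⟨ cong₂ (λ x y → (x - + 2 - y) * + b - (+ d ℤ.+ + m ℤ.+ + 2 - y) * + a)
           (ℤ.pos-* 2 (d + m)) (ℤ.pos-* 3 d) ⟨
    _ ∎
    where
    identity : ∀ d m a b →
      (d * a ℤ.+ d * a) ℤ.+ (d * a ℤ.+ d * a) ℤ.+ (m * b ℤ.+ m * b)
        - (d * (a ℤ.+ b) ℤ.+ (d ℤ.+ m) * a ℤ.+ (a ℤ.+ a) ℤ.+ (b ℤ.+ b))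
      ≡ (+ 2 * (d ℤ.+ m) - + 2 - + 3 * d) * b - (d ℤ.+ m ℤ.+ + 2 - + 3 * d) * a
    identity = ℤ-Solver.solve-∀

mainTheorem6 : (n k : ℕ) (h : Fin k → ℕ) → IsPartition n k h →
    (B : Array k) → IsValidArray k h B →
    (D : Subset k) →
    (+ (2 Data.Nat.* k) - + 2 - + (3 Data.Nat.* ∣ D ∣)) * + sumIn (∁ D) h
      ≥ (+ (k Data.Nat.+ 2) - + (3 Data.Nat.* ∣ D ∣)) * + sumIn D h
mainTheorem6 _ k h _ B valid D =
  counting-bound⇒inequality ∣ D ∣ ∣ ∁ D ∣ (sumIn D h) (sumIn (∁ D) h) (∣p∣+∣∁p∣≡n D)
    (ValidArray.counting-bound valid D)
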